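{- For an integer $n\ge 1$ define \[ A_{2n} = \sum_{\substack{k\ge 1\\ k \equiv 1,4 \ (\mathrm{mod}\ 5)}} \binom{2n}{n+k}, \qquad B_{2n} = \sum_{\substack{k\ge 1\\ k \equiv 2,3 \ (\mathrm{mod}\ 5)}} \binom{2n}{n+k}, \qquad C_{2n} = \sum_{j \geq 1} \binom{2n}{n+5j}. \] Then \[ A_{2n} = \frac{1}{5}\left(2^{2n} + L_{2n-1}\right), \qquad B_{2n} = \frac{1}{5}\left(2^{2n} - L_{2n+1}\right), \] and \[ C_{2n} = \frac{1}{5}\left(2^{2n-1} + L_{2n}\right) - \binom{2n-1}{n}, \] where $L_m$ denotes the $m$-th Lucas number.
   Context: Binomial coefficients $\binom{m}{i}$ are taken to be $0$ for $i<0$ and for $i>m$, so all sums are finite. Lucas numbers: $L_0=2$, $L_1=1$, $L_m=L_{m-1}+L_{m-2}$. -}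

module Defs where

open import Data.Nat using (ℕ; zero; suc; _+_; _*_; _%_)
open import Data.Bool using (Bool; true; false; if_then_else_; _∨_)
open import Data.Nat using (_≡ᵇ_)

L : ℕ → ℕ
L zero = 2
L (suc zero) = 1
L (suc (suc m)) = L (suc m) + L m

sumFrom1 : ℕ → (ℕ → ℕ) → ℕ
sumFrom1 zero f = zero
sumFrom1 (suc n) f = sumFrom1 n f + f (suc n)

when : Bool → ℕ → ℕ
when b x = if b then x else 0

-- Write c n k = C(2n, n+k) and F r = Σ_{k ≥ 1, k ≡ r (5)} c n k.  Applying Pascal's rule twice,
-- c (n+1) k = c n (k-1) + 2 c n k + c n (k+1), so the class sums of row 2n+2 are determined by those
-- of row 2n.  In terms of a = F 1 + F 4, b = F 2 + F 3 and x = 2 F 0 + C(2n, n) (which is the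
-- sum over all k ≡ 0 (5) in ℤ, folded by symmetry) the recurrence is the linear system
--   a' = x + 2a + b,   b' = a + 3b,   x' = 2a + 2x.
-- The closed forms 5a = 4^n + L(2n-1), 5b = 4^n - L(2n+1), 5x = 4^n + 2 L(2n) are then checked by
-- induction on n, using only L(m+2) = L(m+1) + L m.
module Submission where

open import Defs
open import Data.Nat using (ℕ; zero; suc; _+_; _*_; _^_; _%_; _≡ᵇ_; _∸_; _<_; s≤s; pred; NonZero)
open import Data.Nat.Properties
open import Data.Nat.Combinatorics using (_C_; k>n⇒nCk≡0; nCk≡nC[n∸k]; nCk+nC[k+1]≡[n+1]C[k+1])
open import Data.Nat.DivMod using ([m+n]%n≡m%n; [m+kn]%n≡m%n)
open import Data.Nat.Tactic.RingSolver using (solve-∀)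
open import Data.Fin using (Fin; toℕ; #_) renaming (zero to fzero; suc to fsuc)
open import Data.Bool using (Bool; true; false; T; _∨_)
open import Data.Empty using (⊥-elim)
open import Data.Product using (_×_; _,_; proj₁; proj₂)
open import Function using (_∘_)
open import Relation.Binary.PropositionalEquality
open ≡-Reasoning

sumFrom1-cong : ∀ M {f h : ℕ → ℕ} → (∀ j → f (suc j) ≡ h (suc j)) →
  sumFrom1 M f ≡ sumFrom1 M h
sumFrom1-cong zero    eq = refl
sumFrom1-cong (suc M) eq = cong₂ _+_ (sumFrom1-cong M eq) (eq M)

sumFrom1-distrib-+ : ∀ M (f h : ℕ → ℕ) →
  sumFrom1 M (λ k → f k + h k) ≡ sumFrom1 M f + sumFrom1 M h
sumFrom1-distrib-+ zero    f h = refl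
sumFrom1-distrib-+ (suc M) f h =
  trans (cong (_+ (f (suc M) + h (suc M))) (sumFrom1-distrib-+ M f h))
        (+-interchange (sumFrom1 M f) (sumFrom1 M h) (f (suc M)) (h (suc M)))
  where
  +-interchange : ∀ a b c d → a + b + (c + d) ≡ a + c + (b + d)
  +-interchange = solve-∀

sumFrom1-suc : ∀ M (f : ℕ → ℕ) → sumFrom1 (suc M) f ≡ f 1 + sumFrom1 M (f ∘ suc)
sumFrom1-suc zero    f = +-comm 0 (f 1)
sumFrom1-suc (suc M) f = trans (cong (_+ f (2 + M)) (sumFrom1-suc M f)) (+-assoc (f 1) _ _)

sumFrom1-pad : ∀ d K (f : ℕ → ℕ) → (∀ k → K < k → f k ≡ 0) →
  sumFrom1 (d + K) f ≡ sumFrom1 K f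
sumFrom1-pad zero    K f vanish = refl
sumFrom1-pad (suc d) K f vanish =
  trans (cong₂ _+_ (sumFrom1-pad d K f vanish) (vanish (suc (d + K)) (s≤s (m≤n+m K d))))
        (+-identityʳ _)

when-zero : ∀ b → when b 0 ≡ 0
when-zero true  = refl
when-zero false = refl

when-distrib-pascal : ∀ b x y z →
  when b (x + (y + y) + z) ≡ when b x + (when b y + when b y) + when b z
when-distrib-pascal true  x y z = refl
when-distrib-pascal false x y z = refl

when-∨-≡ᵇ : ∀ {i j} → i ≢ j → ∀ m x →
  when ((m ≡ᵇ i) ∨ (m ≡ᵇ j)) x ≡ when (m ≡ᵇ i) x + when (m ≡ᵇ j) x
when-∨-≡ᵇ {i} {j} i≢j m x with m ≡ᵇ i in m≡i | m ≡ᵇ j in m≡j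
... | false | _     = refl
... | true  | false = sym (+-identityʳ x)
... | true  | true  = ⊥-elim (i≢j (trans (sym (≡ᵇ⇒≡ m i (subst T (sym m≡i) _)))
                                          (≡ᵇ⇒≡ m j (subst T (sym m≡j) _))))

-- Residues modulo 5

-- Unlike _%_, mod5 reduces by pattern matching, which makes case analysis on residues possible.
mod5 : ℕ → ℕ
mod5 (suc (suc (suc (suc (suc k))))) = mod5 k
mod5 k = k

m%5≡mod5 : ∀ k → k % 5 ≡ mod5 k
m%5≡mod5 0 = refl
m%5≡mod5 1 = refl
m%5≡mod5 2 = refl
m%5≡mod5 3 = refl
m%5≡mod5 4 = refl
m%5≡mod5 (suc (suc (suc (suc (suc k))))) =
  trans (cong (_% 5) (+-comm 5 k)) (trans ([m+n]%n≡m%n k 5) (m%5≡mod5 k))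

mod5-consecutive : (Q : ℕ → ℕ → Set) → Q 0 1 → Q 1 2 → Q 2 3 → Q 3 4 → Q 4 0 →
  ∀ k → Q (mod5 k) (mod5 (suc k))
mod5-consecutive Q q₀ q₁ q₂ q₃ q₄ 0 = q₀
mod5-consecutive Q q₀ q₁ q₂ q₃ q₄ 1 = q₁
mod5-consecutive Q q₀ q₁ q₂ q₃ q₄ 2 = q₂
mod5-consecutive Q q₀ q₁ q₂ q₃ q₄ 3 = q₃
mod5-consecutive Q q₀ q₁ q₂ q₃ q₄ 4 = q₄
mod5-consecutive Q q₀ q₁ q₂ q₃ q₄ (suc (suc (suc (suc (suc k))))) =
  mod5-consecutive Q q₀ q₁ q₂ q₃ q₄ k

inClass : Fin 5 → ℕ → Bool
inClass r k = k % 5 ≡ᵇ toℕ r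

next : Fin 5 → Fin 5
next fzero                             = # 1
next (fsuc fzero)                      = # 2
next (fsuc (fsuc fzero))               = # 3
next (fsuc (fsuc (fsuc fzero)))        = # 4
next (fsuc (fsuc (fsuc (fsuc fzero)))) = # 0

inClass-next : ∀ r k → inClass (next r) (suc k) ≡ inClass r k
inClass-next r k rewrite m%5≡mod5 k | m%5≡mod5 (suc k) = shift r k
  where
  Shifted : Fin 5 → ℕ → ℕ → Set
  Shifted r a b = (b ≡ᵇ toℕ (next r)) ≡ (a ≡ᵇ toℕ r)
  shift : ∀ r k → Shifted r (mod5 k) (mod5 (suc k))
  shift r@fzero                             = mod5-consecutive (Shifted r) refl refl refl refl refl
  shift r@(fsuc fzero)                      = mod5-consecutive (Shifted r) refl refl refl refl refl
  shift r@(fsuc (fsuc fzero))               = mod5-consecutive (Shifted r) refl refl refl refl refl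
  shift r@(fsuc (fsuc (fsuc fzero)))        = mod5-consecutive (Shifted r) refl refl refl refl refl
  shift r@(fsuc (fsuc (fsuc (fsuc fzero)))) = mod5-consecutive (Shifted r) refl refl refl refl refl

mod5-periodic : ∀ i M → (i + 5 * M) % 5 ≡ i % 5
mod5-periodic i M = trans (cong (λ t → (i + t) % 5) (*-comm 5 M)) ([m+kn]%n≡m%n i M 5)

sumFrom1-multiples-of-5 : ∀ M (h : ℕ → ℕ) →
  sumFrom1 (5 * M) (λ k → when (inClass (# 0) k) (h k)) ≡ sumFrom1 M (λ j → h (5 * j))
sumFrom1-multiples-of-5 zero    h = refl
sumFrom1-multiples-of-5 (suc M) h = begin
  sumFrom1 (5 * suc M) f
    ≡⟨ cong (λ t → sumFrom1 t f) (*-suc 5 M) ⟩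
  sumFrom1 (5 * M) f + f (1 + 5 * M) + f (2 + 5 * M) + f (3 + 5 * M) + f (4 + 5 * M) + f (5 + 5 * M)
    ≡⟨ drop-zeros {sumFrom1 (5 * M) f} (term 1) (term 2) (term 3) (term 4) ⟩
  sumFrom1 (5 * M) f + f (5 + 5 * M)
    ≡⟨ cong₂ _+_ (sumFrom1-multiples-of-5 M h) (term 5) ⟩
  sumFrom1 M (λ j → h (5 * j)) + h (5 + 5 * M)
    ≡⟨ cong (λ t → sumFrom1 M (λ j → h (5 * j)) + h t) (sym (*-suc 5 M)) ⟩
  sumFrom1 (suc M) (λ j → h (5 * j)) ∎
  where
  f : ℕ → ℕ
  f k = when (inClass (# 0) k) (h k)
  term : ∀ i → f (i + 5 * M) ≡ when (i % 5 ≡ᵇ 0) (h (i + 5 * M))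
  term i = cong (λ r → when (r ≡ᵇ 0) (h (i + 5 * M))) (mod5-periodic i M)
  drop-zeros : ∀ {s a b c d e} → a ≡ 0 → b ≡ 0 → c ≡ 0 → d ≡ 0 →
               s + a + b + c + d + e ≡ s + e
  drop-zeros {s} refl refl refl refl =
    cong (_+ _) (trans (+-identityʳ _) (trans (+-identityʳ _) (trans (+-identityʳ _) (+-identityʳ s))))

-- Binomial coefficients

C-symmetric : ∀ a b → (a + b) C a ≡ (a + b) C b
C-symmetric a b = trans (nCk≡nC[n∸k] (m≤m+n a b)) (cong ((a + b) C_) (m+n∸m≡n a b))

pascal² : ∀ a b → suc (suc a) C suc (suc b) ≡ a C b + (a C suc b + a C suc b) + a C suc (suc b)
pascal² a b = begin
  suc (suc a) C suc (suc b)
    ≡⟨ sym (nCk+nC[k+1]≡[n+1]C[k+1] (suc a) (suc b)) ⟩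
  suc a C suc b + suc a C suc (suc b)
    ≡⟨ sym (cong₂ _+_ (nCk+nC[k+1]≡[n+1]C[k+1] a b) (nCk+nC[k+1]≡[n+1]C[k+1] a (suc b))) ⟩
  (a C b + a C suc b) + (a C suc b + a C suc (suc b))
    ≡⟨ regroup (a C b) (a C suc b) (a C suc (suc b)) ⟩
  a C b + (a C suc b + a C suc b) + a C suc (suc b) ∎
  where
  regroup : ∀ x y z → (x + y) + (y + z) ≡ x + (y + y) + z
  regroup = solve-∀

centred : ℕ → ℕ → ℕ
centred n k = 2 * n C (n + k)

centred-vanishes : ∀ n k → 2 * n < k → centred n k ≡ 0
centred-vanishes n k 2n<k = k>n⇒nCk≡0 (<-≤-trans 2n<k (m≤n+m k n))

centred-pascal : ∀ n j →
  centred (suc n) (suc j) ≡ centred n j + (centred n (suc j) + centred n (suc j)) + centred n (suc (suc j))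
centred-pascal n j = begin
  2 * suc n C (suc n + suc j)
    ≡⟨ cong₂ _C_ (*-suc 2 n) (cong suc (+-suc n j)) ⟩
  suc (suc (2 * n)) C suc (suc (n + j))
    ≡⟨ pascal² (2 * n) (n + j) ⟩
  2 * n C (n + j) + (2 * n C suc (n + j) + 2 * n C suc (n + j)) + 2 * n C suc (suc (n + j))
    ≡⟨ cong₂ (λ s t → 2 * n C (n + j) + (2 * n C s + 2 * n C s) + 2 * n C t)
         (sym (+-suc n j)) (sym (trans (+-suc n (suc j)) (cong suc (+-suc n j)))) ⟩
  centred n j + (centred n (suc j) + centred n (suc j)) + centred n (suc (suc j)) ∎

centred-zero : ∀ n → centred n 0 ≡ 2 * n C n
centred-zero n = cong (2 * n C_) (+-identityʳ n)

centralBinomial-suc : ∀ n → 2 * suc n C suc n ≡ 2 * (suc (2 * n) C suc n)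
centralBinomial-suc n = begin
  2 * suc n C suc n                       ≡⟨ cong (_C suc n) (*-suc 2 n) ⟩
  suc (suc (2 * n)) C suc n               ≡⟨ sym (nCk+nC[k+1]≡[n+1]C[k+1] (suc (2 * n)) n) ⟩
  suc (2 * n) C n + suc (2 * n) C suc n   ≡⟨ cong (_+ suc (2 * n) C suc n) symmetric ⟩
  suc (2 * n) C suc n + suc (2 * n) C suc n ≡⟨ sym (cong (suc (2 * n) C suc n +_) (+-identityʳ _)) ⟩
  2 * (suc (2 * n) C suc n) ∎
  where
  1+2n≡n+[1+n] : ∀ n → suc (2 * n) ≡ n + suc n
  1+2n≡n+[1+n] = solve-∀
  symmetric : suc (2 * n) C n ≡ suc (2 * n) C suc n
  symmetric = subst (λ t → t C n ≡ t C suc n) (sym (1+2n≡n+[1+n] n)) (C-symmetric n (suc n))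

centred-suc-zero : ∀ n → centred (suc n) 0 ≡ 2 * (centred n 0 + centred n 1)
centred-suc-zero n = begin
  centred (suc n) 0                       ≡⟨ centred-zero (suc n) ⟩
  2 * suc n C suc n                       ≡⟨ centralBinomial-suc n ⟩
  2 * (suc (2 * n) C suc n)               ≡⟨ cong (2 *_) (sym (nCk+nC[k+1]≡[n+1]C[k+1] (2 * n) n)) ⟩
  2 * (2 * n C n + 2 * n C suc n)
    ≡⟨ cong₂ (λ s t → 2 * (s + t)) (sym (centred-zero n)) (cong (2 * n C_) (+-comm 1 n)) ⟩
  2 * (centred n 0 + centred n 1) ∎

-- Weighted sums over one half of row 2n

weightedSum : ℕ → (ℕ → Bool) → ℕ
weightedSum n w = sumFrom1 (2 * n) (λ k → when (w k) (centred n k))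

weightedSum-pad : ∀ d n (w : ℕ → Bool) →
  sumFrom1 (d + 2 * n) (λ k → when (w k) (centred n k)) ≡ weightedSum n w
weightedSum-pad d n w = sumFrom1-pad d (2 * n) _ λ k 2n<k →
  trans (cong (when (w k)) (centred-vanishes n k 2n<k)) (when-zero (w k))

weightedSum-cong : ∀ n (w v : ℕ → Bool) → (∀ j → w (suc j) ≡ v (suc j)) →
  weightedSum n w ≡ weightedSum n v
weightedSum-cong n w v w≡v =
  sumFrom1-cong (2 * n) λ j → cong (λ b → when b (centred n (suc j))) (w≡v j)

-- Pascal's rule twice, then reindexing; the index k = 0 is not in the range of summation, whence the
-- two boundary terms.
weightedSum-suc : ∀ n w →
  weightedSum (suc n) w + when (w 0) (centred n 1)
  ≡ when (w 1) (centred n 0) + weightedSum n (w ∘ suc) + (weightedSum n w + weightedSum n w)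
    + weightedSum n (w ∘ pred)
weightedSum-suc n w = begin
  weightedSum (suc n) w + boundary
    ≡⟨ cong (λ t → sumFrom1 t (λ k → when (w k) (centred (suc n) k)) + boundary) (*-suc 2 n) ⟩
  sumFrom1 (2 + N) (λ k → when (w k) (centred (suc n) k)) + boundary
    ≡⟨ cong (_+ boundary) (sumFrom1-cong (2 + N) pascal) ⟩
  sumFrom1 (2 + N) (λ k → below k + (at k + at k) + above k) + boundary
    ≡⟨ cong (_+ boundary) split ⟩
  Σ below + (Σ at + Σ at) + Σ above + boundary
    ≡⟨ +-assoc (Σ below + (Σ at + Σ at)) (Σ above) boundary ⟩
  Σ below + (Σ at + Σ at) + (Σ above + boundary)
    ≡⟨ cong₂ _+_ (cong₂ (λ s t → s + (t + t)) below-sum (weightedSum-pad 2 n w)) above-sum ⟩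
  when (w 1) (centred n 0) + weightedSum n (w ∘ suc) + (weightedSum n w + weightedSum n w)
    + weightedSum n (w ∘ pred) ∎
  where
  N : ℕ
  N = 2 * n
  Σ : (ℕ → ℕ) → ℕ
  Σ = sumFrom1 (2 + N)
  boundary : ℕ
  boundary = when (w 0) (centred n 1)
  below at above : ℕ → ℕ
  below k = when (w k) (centred n (pred k))
  at    k = when (w k) (centred n k)
  above k = when (w k) (centred n (suc k))
  pascal : ∀ j → when (w (suc j)) (centred (suc n) (suc j))
                 ≡ below (suc j) + (at (suc j) + at (suc j)) + above (suc j)
  pascal j = trans (cong (when (w (suc j))) (centred-pascal n j)) (when-distrib-pascal (w (suc j)) _ _ _)
  split : Σ (λ k → below k + (at k + at k) + above k) ≡ Σ below + (Σ at + Σ at) + Σ above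
  split = begin
    Σ (λ k → below k + (at k + at k) + above k)
      ≡⟨ sumFrom1-distrib-+ (2 + N) _ above ⟩
    Σ (λ k → below k + (at k + at k)) + Σ above
      ≡⟨ cong (_+ Σ above) (sumFrom1-distrib-+ (2 + N) below _) ⟩
    Σ below + Σ (λ k → at k + at k) + Σ above
      ≡⟨ cong (λ t → Σ below + t + Σ above) (sumFrom1-distrib-+ (2 + N) at at) ⟩
    Σ below + (Σ at + Σ at) + Σ above ∎
  below-sum : Σ below ≡ when (w 1) (centred n 0) + weightedSum n (w ∘ suc)
  below-sum = trans (sumFrom1-suc (1 + N) below) (cong (below 1 +_) (weightedSum-pad 1 n (w ∘ suc)))
  above-sum : Σ above + boundary ≡ weightedSum n (w ∘ pred)
  above-sum = begin
    Σ above + boundary  ≡⟨ +-comm (Σ above) boundary ⟩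
    boundary + Σ above  ≡⟨ sym (sumFrom1-suc (2 + N) (λ k → when (w (pred k)) (centred n k))) ⟩
    sumFrom1 (3 + N) (λ k → when (w (pred k)) (centred n k))  ≡⟨ weightedSum-pad 3 n (w ∘ pred) ⟩
    weightedSum n (w ∘ pred) ∎

classSum : ℕ → Fin 5 → ℕ
classSum n r = weightedSum n (inClass r)

classSum-suc : ∀ n r →
  classSum (suc n) (next r) + when (inClass (next r) 0) (centred n 1)
  ≡ when (inClass (next r) 1) (centred n 0) + classSum n r + (classSum n (next r) + classSum n (next r))
    + classSum n (next (next r))
classSum-suc n r = trans (weightedSum-suc n (inClass (next r)))
  (cong₂ (λ s t → when (inClass (next r) 1) (centred n 0) + s + (F (next r) + F (next r)) + t)
    (weightedSum-cong n (inClass (next r) ∘ suc) (inClass r) (inClass-next r ∘ suc))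
    (weightedSum-cong n (inClass (next r) ∘ pred) (inClass (next (next r)))
      (sym ∘ inClass-next (next r))))
  where
  F : Fin 5 → ℕ
  F = classSum n

sum₁₄ sum₂₃ sum₀ : ℕ → ℕ
sum₁₄ n = classSum n (# 1) + classSum n (# 4)
sum₂₃ n = classSum n (# 2) + classSum n (# 3)
sum₀  n = 2 * classSum n (# 0) + centred n 0

sum₁₄-suc : ∀ n → sum₁₄ (suc n) ≡ sum₀ n + 2 * sum₁₄ n + sum₂₃ n
sum₁₄-suc n = begin
  F′ (# 1) + F′ (# 4)             ≡⟨ cong₂ _+_ (+-identityʳ (F′ (# 1))) (+-identityʳ (F′ (# 4))) ⟨
  (F′ (# 1) + 0) + (F′ (# 4) + 0) ≡⟨ cong₂ _+_ (classSum-suc n (# 0)) (classSum-suc n (# 3)) ⟩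
  (c + F (# 0) + (F (# 1) + F (# 1)) + F (# 2)) + (F (# 3) + (F (# 4) + F (# 4)) + F (# 0))
    ≡⟨ regroup c (F (# 0)) (F (# 1)) (F (# 2)) (F (# 3)) (F (# 4)) ⟩
  sum₀ n + 2 * sum₁₄ n + sum₂₃ n ∎
  where
  F F′ : Fin 5 → ℕ
  F  = classSum n
  F′ = classSum (suc n)
  c : ℕ
  c = centred n 0
  regroup : ∀ c f₀ f₁ f₂ f₃ f₄ → (c + f₀ + (f₁ + f₁) + f₂) + (f₃ + (f₄ + f₄) + f₀)
                                 ≡ (2 * f₀ + c) + 2 * (f₁ + f₄) + (f₂ + f₃)
  regroup = solve-∀

sum₂₃-suc : ∀ n → sum₂₃ (suc n) ≡ sum₁₄ n + 3 * sum₂₃ n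
sum₂₃-suc n = begin
  F′ (# 2) + F′ (# 3)             ≡⟨ cong₂ _+_ (+-identityʳ (F′ (# 2))) (+-identityʳ (F′ (# 3))) ⟨
  (F′ (# 2) + 0) + (F′ (# 3) + 0) ≡⟨ cong₂ _+_ (classSum-suc n (# 1)) (classSum-suc n (# 2)) ⟩
  (F (# 1) + (F (# 2) + F (# 2)) + F (# 3)) + (F (# 2) + (F (# 3) + F (# 3)) + F (# 4))
    ≡⟨ regroup (F (# 1)) (F (# 2)) (F (# 3)) (F (# 4)) ⟩
  sum₁₄ n + 3 * sum₂₃ n ∎
  where
  F F′ : Fin 5 → ℕ
  F  = classSum n
  F′ = classSum (suc n)
  regroup : ∀ f₁ f₂ f₃ f₄ → (f₁ + (f₂ + f₂) + f₃) + (f₂ + (f₃ + f₃) + f₄)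
                           ≡ (f₁ + f₄) + 3 * (f₂ + f₃)
  regroup = solve-∀

sum₀-suc : ∀ n → sum₀ (suc n) ≡ 2 * (sum₁₄ n + sum₀ n)
sum₀-suc n = begin
  2 * F′ (# 0) + centred (suc n) 0          ≡⟨ cong (2 * F′ (# 0) +_) (centred-suc-zero n) ⟩
  2 * F′ (# 0) + 2 * (c₀ + c₁)              ≡⟨ regroup₁ (F′ (# 0)) c₀ c₁ ⟩
  2 * (F′ (# 0) + c₁) + 2 * c₀              ≡⟨ cong (λ t → 2 * t + 2 * c₀) (classSum-suc n (# 4)) ⟩
  2 * (F (# 4) + (F (# 0) + F (# 0)) + F (# 1)) + 2 * c₀
    ≡⟨ regroup₂ (F (# 0)) (F (# 1)) (F (# 4)) c₀ ⟩
  2 * (sum₁₄ n + sum₀ n) ∎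
  where
  F F′ : Fin 5 → ℕ
  F  = classSum n
  F′ = classSum (suc n)
  c₀ c₁ : ℕ
  c₀ = centred n 0
  c₁ = centred n 1
  regroup₁ : ∀ f c₀ c₁ → 2 * f + 2 * (c₀ + c₁) ≡ 2 * (f + c₁) + 2 * c₀
  regroup₁ = solve-∀
  regroup₂ : ∀ f₀ f₁ f₄ c₀ → 2 * (f₄ + (f₀ + f₀) + f₁) + 2 * c₀
                             ≡ 2 * ((f₁ + f₄) + (2 * f₀ + c₀))
  regroup₂ = solve-∀

-- Lucas closed forms

LucasClosedForm : (a b x p t : ℕ) → Set
LucasClosedForm a b x p t = (5 * a + L t ≡ p + L (suc t))
                          × (5 * b + L (suc t) ≡ p)
                          × (5 * x ≡ p + 2 * L t)

LucasClosedForm-resp : ∀ {a a′ b b′ x x′ p t t′} →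
  a ≡ a′ → b ≡ b′ → x ≡ x′ → t ≡ t′ →
  LucasClosedForm a b x p t → LucasClosedForm a′ b′ x′ p t′
LucasClosedForm-resp refl refl refl refl closed = closed

lucasClosedForm-step : ∀ {a b x p t} → LucasClosedForm a b x p t →
  LucasClosedForm (x + 2 * a + b) (a + 3 * b) (2 * (a + x)) (4 * p) (suc (suc t))
lucasClosedForm-step {a} {b} {x} {t = t} (5a≡ , refl , 5x≡) = next-a , next-b , next-x
  where
  l₀ l₁ : ℕ
  l₀ = L t
  l₁ = L (suc t)
  next-a : 5 * (x + 2 * a + b) + (l₁ + l₀) ≡ 4 * (5 * b + l₁) + (l₁ + l₀ + l₁)
  next-a = +-cancelʳ-≡ l₀ _ _ (begin
    5 * (x + 2 * a + b) + (l₁ + l₀) + l₀       ≡⟨ regroup₁ x a b l₀ l₁ ⟩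
    5 * x + 2 * (5 * a + l₀) + 5 * b + l₁      ≡⟨ cong₂ (λ s t → s + 2 * t + 5 * b + l₁) 5x≡ 5a≡ ⟩
    (5 * b + l₁ + 2 * l₀) + 2 * (5 * b + l₁ + l₁) + 5 * b + l₁  ≡⟨ regroup₂ b l₀ l₁ ⟩
    4 * (5 * b + l₁) + (l₁ + l₀ + l₁) + l₀ ∎)
    where
    regroup₁ : ∀ x a b l₀ l₁ → 5 * (x + 2 * a + b) + (l₁ + l₀) + l₀
                               ≡ 5 * x + 2 * (5 * a + l₀) + 5 * b + l₁
    regroup₁ = solve-∀
    regroup₂ : ∀ b l₀ l₁ → (5 * b + l₁ + 2 * l₀) + 2 * (5 * b + l₁ + l₁) + 5 * b + l₁
                           ≡ 4 * (5 * b + l₁) + (l₁ + l₀ + l₁) + l₀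
    regroup₂ = solve-∀
  next-b : 5 * (a + 3 * b) + (l₁ + l₀ + l₁) ≡ 4 * (5 * b + l₁)
  next-b = begin
    5 * (a + 3 * b) + (l₁ + l₀ + l₁)           ≡⟨ regroup₁ a b l₀ l₁ ⟩
    (5 * a + l₀) + 15 * b + 2 * l₁             ≡⟨ cong (λ t → t + 15 * b + 2 * l₁) 5a≡ ⟩
    (5 * b + l₁ + l₁) + 15 * b + 2 * l₁        ≡⟨ regroup₂ b l₁ ⟩
    4 * (5 * b + l₁) ∎
    where
    regroup₁ : ∀ a b l₀ l₁ → 5 * (a + 3 * b) + (l₁ + l₀ + l₁)
                             ≡ (5 * a + l₀) + 15 * b + 2 * l₁
    regroup₁ = solve-∀
    regroup₂ : ∀ b l₁ → (5 * b + l₁ + l₁) + 15 * b + 2 * l₁ ≡ 4 * (5 * b + l₁)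
    regroup₂ = solve-∀
  next-x : 5 * (2 * (a + x)) ≡ 4 * (5 * b + l₁) + 2 * (l₁ + l₀)
  next-x = +-cancelʳ-≡ (2 * l₀) _ _ (begin
    5 * (2 * (a + x)) + 2 * l₀                 ≡⟨ regroup₁ a x l₀ ⟩
    2 * (5 * a + l₀) + 2 * (5 * x)             ≡⟨ cong₂ (λ s t → 2 * s + 2 * t) 5a≡ 5x≡ ⟩
    2 * (5 * b + l₁ + l₁) + 2 * (5 * b + l₁ + 2 * l₀)  ≡⟨ regroup₂ b l₀ l₁ ⟩
    4 * (5 * b + l₁) + 2 * (l₁ + l₀) + 2 * l₀ ∎)
    where
    regroup₁ : ∀ a x l₀ → 5 * (2 * (a + x)) + 2 * l₀ ≡ 2 * (5 * a + l₀) + 2 * (5 * x)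
    regroup₁ = solve-∀
    regroup₂ : ∀ b l₀ l₁ → 2 * (5 * b + l₁ + l₁) + 2 * (5 * b + l₁ + 2 * l₀)
                           ≡ 4 * (5 * b + l₁) + 2 * (l₁ + l₀) + 2 * l₀
    regroup₂ = solve-∀

lucasClosedForm : ∀ n → LucasClosedForm (sum₁₄ n) (sum₂₃ n) (sum₀ n) (4 ^ n) (2 * n)
lucasClosedForm zero    = refl , refl , refl
lucasClosedForm (suc n) =
  LucasClosedForm-resp (sym (sum₁₄-suc n)) (sym (sum₂₃-suc n)) (sym (sum₀-suc n)) (sym (*-suc 2 n))
    (lucasClosedForm-step {sum₁₄ n} {sum₂₃ n} {sum₀ n} {t = 2 * n} (lucasClosedForm n))

L-suc : ∀ t .{{_ : NonZero t}} → L (suc t) ≡ L t + L (t ∸ 1)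
L-suc (suc t) = refl

4^n≡2^[2n] : ∀ n → 4 ^ n ≡ 2 ^ (2 * n)
4^n≡2^[2n] = ^-*-assoc 2 2

5*sum₁₄ : ∀ m → 5 * sum₁₄ (suc m) ≡ 2 ^ (2 * suc m) + L (2 * suc m ∸ 1)
5*sum₁₄ m = +-cancelʳ-≡ (L (2 * n)) _ _ (begin
  5 * sum₁₄ n + L (2 * n)                 ≡⟨ proj₁ (lucasClosedForm n) ⟩
  4 ^ n + L (suc (2 * n))                 ≡⟨ cong₂ _+_ (4^n≡2^[2n] n) (L-suc (2 * n)) ⟩
  2 ^ (2 * n) + (L (2 * n) + L (2 * n ∸ 1)) ≡⟨ cong (2 ^ (2 * n) +_) (+-comm (L (2 * n)) _) ⟩
  2 ^ (2 * n) + (L (2 * n ∸ 1) + L (2 * n)) ≡⟨ +-assoc (2 ^ (2 * n)) _ _ ⟨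
  2 ^ (2 * n) + L (2 * n ∸ 1) + L (2 * n) ∎)
  where
  n : ℕ
  n = suc m

5*sum₂₃ : ∀ n → 5 * sum₂₃ n + L (2 * n + 1) ≡ 2 ^ (2 * n)
5*sum₂₃ n = begin
  5 * sum₂₃ n + L (2 * n + 1)   ≡⟨ cong (λ t → 5 * sum₂₃ n + L t) (+-comm (2 * n) 1) ⟩
  5 * sum₂₃ n + L (suc (2 * n)) ≡⟨ proj₁ (proj₂ (lucasClosedForm n)) ⟩
  4 ^ n                         ≡⟨ 4^n≡2^[2n] n ⟩
  2 ^ (2 * n) ∎

centred-zero≡2*[2n∸1]Cn : ∀ m → centred (suc m) 0 ≡ 2 * ((2 * suc m ∸ 1) C suc m)
centred-zero≡2*[2n∸1]Cn m = begin
  centred (suc m) 0                 ≡⟨ centred-zero (suc m) ⟩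
  2 * suc m C suc m                 ≡⟨ centralBinomial-suc m ⟩
  2 * (suc (2 * m) C suc m)         ≡⟨ cong (λ t → 2 * ((t ∸ 1) C suc m)) (*-suc 2 m) ⟨
  2 * ((2 * suc m ∸ 1) C suc m) ∎

5*[classSum₀+[2n∸1]Cn] : ∀ m →
  5 * (classSum (suc m) (# 0) + (2 * suc m ∸ 1) C suc m) ≡ 2 ^ (2 * suc m ∸ 1) + L (2 * suc m)
5*[classSum₀+[2n∸1]Cn] m = *-cancelˡ-≡ _ _ 2 (begin
  2 * (5 * (f + h))                 ≡⟨ regroup f h ⟩
  5 * (2 * f + 2 * h)               ≡⟨ cong (λ t → 5 * (2 * f + t)) (centred-zero≡2*[2n∸1]Cn m) ⟨
  5 * sum₀ n                        ≡⟨ proj₂ (proj₂ (lucasClosedForm n)) ⟩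
  4 ^ n + 2 * L (2 * n)             ≡⟨ cong (_+ 2 * L (2 * n)) (4^n≡2^[2n] n) ⟩
  2 * 2 ^ (2 * n ∸ 1) + 2 * L (2 * n) ≡⟨ *-distribˡ-+ 2 (2 ^ (2 * n ∸ 1)) (L (2 * n)) ⟨
  2 * (2 ^ (2 * n ∸ 1) + L (2 * n)) ∎)
  where
  n f h : ℕ
  n = suc m
  f = classSum n (# 0)
  h = (2 * n ∸ 1) C n
  regroup : ∀ f h → 2 * (5 * (f + h)) ≡ 5 * (2 * f + 2 * h)
  regroup = solve-∀

weightedSum-∨-residues : ∀ n {i j} → i ≢ j →
  sumFrom1 (2 * n) (λ k → when ((k % 5 ≡ᵇ i) ∨ (k % 5 ≡ᵇ j)) (centred n k))
  ≡ weightedSum n (λ k → k % 5 ≡ᵇ i) + weightedSum n (λ k → k % 5 ≡ᵇ j)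
weightedSum-∨-residues n i≢j =
  trans (sumFrom1-cong (2 * n) λ k → when-∨-≡ᵇ i≢j (suc k % 5) (centred n (suc k)))
        (sumFrom1-distrib-+ (2 * n) _ _)

classSum-zero : ∀ n → classSum n (# 0) ≡ sumFrom1 (2 * n) (λ j → centred n (5 * j))
classSum-zero n = begin
  classSum n (# 0)                      ≡⟨ weightedSum-pad (4 * N) n (inClass (# 0)) ⟨
  sumFrom1 (4 * N + N) f                ≡⟨ cong (λ t → sumFrom1 t f) (+-comm (4 * N) N) ⟩
  sumFrom1 (5 * N) f                    ≡⟨ sumFrom1-multiples-of-5 N (centred n) ⟩
  sumFrom1 N (λ j → centred n (5 * j)) ∎
  where
  N : ℕ
  N = 2 * n
  f : ℕ → ℕ
  f k = when (inClass (# 0) k) (centred n k)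

proposition1 : (m : ℕ) →
    let n = suc m
        A₂ₙ = sumFrom1 (2 * n) (λ k → when ((k % 5 ≡ᵇ 1) ∨ (k % 5 ≡ᵇ 4)) ((2 * n) C (n + k)))
        B₂ₙ = sumFrom1 (2 * n) (λ k → when ((k % 5 ≡ᵇ 2) ∨ (k % 5 ≡ᵇ 3)) ((2 * n) C (n + k)))
        C₂ₙ = sumFrom1 (2 * n) (λ j → (2 * n) C (n + 5 * j))
    in (5 * A₂ₙ ≡ 2 ^ (2 * n) + L (2 * n ∸ 1))
       × (5 * B₂ₙ + L (2 * n + 1) ≡ 2 ^ (2 * n))
       × (5 * (C₂ₙ + (2 * n ∸ 1) C n) ≡ 2 ^ (2 * n ∸ 1) + L (2 * n))
proposition1 m =
  trans (cong (5 *_) (weightedSum-∨-residues n (λ ()))) (5*sum₁₄ m) ,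
  trans (cong (λ t → 5 * t + L (2 * n + 1)) (weightedSum-∨-residues n (λ ()))) (5*sum₂₃ n) ,
  trans (cong (λ t → 5 * (t + (2 * n ∸ 1) C n)) (sym (classSum-zero n))) (5*[classSum₀+[2n∸1]Cn] m)
  where
  n : ℕ
  n = suc m
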